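{- If there exist derivations $\Pi$ of $\Gamma, z:\mathcal{C}\vdash^{w}M:\tau$ and $\Phi$ of $\vdash^{v}V:\mathcal{C}$ (with $V$ a value, $\mathcal{C}$ an intersection type and $\tau$ an arrow type, intersection type or type distribution), then there exists a derivation $\Pi'$ of $\Gamma\vdash^{w'}M\{V/z\}:\tau$ such that $w'=w+v$ and $|\Pi'|\le|\Pi|+|\Phi|$.
   Context: Terms: values $V ::= x \mid \lambda x.M$; terms $M ::= V \mid VV \mid M\oplus M \mid \mathtt{let}\ x = M\ \mathtt{in}\ M$; $M\{V/z\}$ is capture-avoiding substitution. Types: arrow types $\mathtt{A} ::= \mathcal{M}\to \mathtt{a}$; intersection types $\mathcal{M} ::= [q_1\cdot \mathtt{A}_1,\dots,q_n\cdot\mathtt{A}_n]$ ($n\ge 0$), a finite multiset of pairs with scale factors $q_i\in(0,1]\cap\mathbb{Q}$; type distributions $\mathtt{a} ::= \langle p_1\mathcal{M}_1,\dots,p_n\mathcal{M}_n\rangle$ ($n\ge0$, $p_i\in(0,1]$, $\sum_i p_i\le 1$). $\mathbf{0}$ is the empty type distribution. For a scalar $u$, $u\cdot[q_i\cdot\mathtt{A}_i]_i=[(uq_i)\cdot \mathtt{A}_i]_i$ and $u\cdot\langle p_i\mathcal{M}_i\rangle_i=\langle (up_i)\mathcal{M}_i\rangle_i$; $\uplus$, $\sqcup$ are multiset unions. Typing contexts map variables to intersection types (finitely many nonempty), with pointwise $\uplus$ and scaling $q\cdot\Gamma$; $\Gamma,z:\mathcal{C}$ requires $z\notin\mathrm{dom}(\Gamma)$.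 Judgements $\Gamma\vdash^{w} M:\tau$ ($w\in\mathbb{Q}$) are derived by: (Var) $x:\mathcal{M}\vdash^0 x:\mathcal{M}$. (Zero) $\vdash^0 M:\mathbf{0}$. (@) from $\Gamma\vdash^{w}V:[1\cdot(\mathcal{M}\to\mathtt{b})]$ and $\Delta\vdash^{v}W:\mathcal{M}$ infer $\Gamma\uplus\Delta\vdash^{w+v}VW:\mathtt{b}$. ($\oplus$) from $\Gamma\vdash^{w}M:\mathtt{a}$, $\Delta\vdash^{v}N:\mathtt{b}$ infer $\tfrac12\cdot\Gamma\uplus\tfrac12\cdot\Delta\vdash^{\frac12 w+\frac12 v+1}M\oplus N:\tfrac12\mathtt{a}\sqcup\tfrac12\mathtt{b}$. ($\lambda$) from $\Gamma,x:\mathcal{M}\vdash^{w}M:\mathtt{b}$ infer $\Gamma\vdash^{w+1}\lambda x.M:\mathcal{M}\to\mathtt{b}$. (let) from $\Gamma\vdash^{v}N:\langle p_k\mathcal{M}_k\rangle_{k\in K}$ and $\Delta_k,x:\mathcal{M}_k\vdash^{w_k}M:\mathtt{b}_k$ ($k\in K$) infer $\Gamma\uplus_{k}p_k\cdot\Delta_k\vdash^{\sum_k p_kw_k+v+1}\mathtt{let}\ x=N\ \mathtt{in}\ M:\bigsqcup_k p_k\mathtt{b}_k$. (Val) from $\Gamma\vdash^{w}V:\mathcal{M}$ infer $\Gamma\vdash^{w}V:\langle 1\mathcal{M}\rangle$. (!) for finite possibly empty $I$, from $\Gamma_i\vdash^{w_i}V:\mathtt{A}_i$ and scale factors $q_i$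 infer $\uplus_i q_i\cdot\Gamma_i\vdash^{\sum_i q_iw_i}V:[q_i\cdot\mathtt{A}_i]_{i\in I}$. The size $|\Pi|$ of a derivation is the number of rule instances in it, not counting instances of (!) and (Val). -}

module Defs where

open import Data.Nat as ℕ using (ℕ; zero; suc; _≡ᵇ_; _<ᵇ_)
open import Data.Rational using (ℚ; 0ℚ; 1ℚ; ½; _+_; _*_; _<_; _≤_)
open import Data.List using (List; []; _∷_; _++_; map)
open import Data.List.Relation.Binary.Permutation.Homogeneous using (Permutation)
open import Data.Product using (_×_; _,_)
open import Data.Bool using (if_then_else_)
open import Relation.Binary.PropositionalEquality using (_≡_)

-- Terms (de Bruijn indices; variable n is the n-th enclosing binder,
-- indices beyond the binders are free variables)

mutual
  data Val : Set where
    var : ℕ → Val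
    lam : Term → Val

  data Term : Set where
    val  : Val → Term
    app  : Val → Val → Term
    _⊕_  : Term → Term → Term
    lett : Term → Term → Term    -- let x = N in M  ==  lett N M, M binds index 0

mutual
  shiftV : ℕ → Val → Val
  shiftV c (var x) = if x <ᵇ c then var x else var (suc x)
  shiftV c (lam M) = lam (shiftT (suc c) M)

  shiftT : ℕ → Term → Term
  shiftT c (val V)    = val (shiftV c V)
  shiftT c (app V W)  = app (shiftV c V) (shiftV c W)
  shiftT c (M ⊕ N)    = shiftT c M ⊕ shiftT c N
  shiftT c (lett N M) = lett (shiftT c N) (shiftT (suc c) M)

-- capture-avoiding substitution  M{V/z}  (z a free index; nothing else renumbered)
mutual
  substV : ℕ → Val → Val → Val
  substV z V (var x) = if x ≡ᵇ z then V else var x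
  substV z V (lam M) = lam (substT (suc z) (shiftV 0 V) M)

  substT : ℕ → Val → Term → Term
  substT z V (val W)    = val (substV z V W)
  substT z V (app W U)  = app (substV z V W) (substV z V U)
  substT z V (M ⊕ N)    = substT z V M ⊕ substT z V N
  substT z V (lett N M) = lett (substT z V N) (substT (suc z) (shiftV 0 V) M)

-- Types.  Multisets are represented by lists; they are identified up to
-- permutation by the equivalence _≈T_ below (used by the conversion rule).

data Arrow : Set where
  _⇒_ : List (ℚ × Arrow) → List (ℚ × List (ℚ × Arrow)) → Arrow

Inter : Set
Inter = List (ℚ × Arrow)

-- type distributions  ⟨p₁M₁,…,pₙMₙ⟩ ;  𝟎 = []
Dist : Set
Dist = List (ℚ × Inter)

data Typ : Set where
  arr  : Arrow → Typ
  int  : Inter → Typ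
  dist : Dist → Typ

sumP : Dist → ℚ
sumP []            = 0ℚ
sumP ((p , _) ∷ a) = p + sumP a

mutual
  data WFA : Arrow → Set where
    wf⇒ : ∀ {M a} → WFI M → WFD a → WFA (M ⇒ a)

  data WFI : Inter → Set where
    []  : WFI []
    _∷_ : ∀ {q A M} → (0ℚ < q × q ≤ 1ℚ × WFA A) → WFI M → WFI ((q , A) ∷ M)

  data WFDe : Dist → Set where
    []  : WFDe []
    _∷_ : ∀ {p M a} → (0ℚ < p × p ≤ 1ℚ × WFI M) → WFDe a → WFDe ((p , M) ∷ a)

  data WFD : Dist → Set where
    wfd : ∀ {a} → WFDe a → sumP a ≤ 1ℚ → WFD a

_·I_ : ℚ → Inter → Inter
u ·I M = map (λ { (q , A) → (u * q , A) }) M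

_·D_ : ℚ → Dist → Dist
u ·D a = map (λ { (p , M) → (u * p , M) }) a

mutual
  data _≈A_ : Arrow → Arrow → Set where
    ≈⇒ : ∀ {M M' a a'} → M ≈I M' → a ≈D a' → (M ⇒ a) ≈A (M' ⇒ a')

  data ElI : ℚ × Arrow → ℚ × Arrow → Set where
    elI : ∀ {q A B} → A ≈A B → ElI (q , A) (q , B)

  data ElD : ℚ × Inter → ℚ × Inter → Set where
    elD : ∀ {p M N} → M ≈I N → ElD (p , M) (p , N)

  data _≈I_ : Inter → Inter → Set where
    perm : ∀ {M N} → Permutation ElI M N → M ≈I N

  data _≈D_ : Dist → Dist → Set where
    perm : ∀ {a b} → Permutation ElD a b → a ≈D b

data _≈T_ : Typ → Typ → Set where
  arr≈  : ∀ {A B} → A ≈A B → arr A ≈T arr B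
  int≈  : ∀ {M N} → M ≈I N → int M ≈T int N
  dist≈ : ∀ {a b} → a ≈D b → dist a ≈T dist b

Ctx : Set
Ctx = ℕ → Inter

∅ : Ctx
∅ _ = []

_⊎_ : Ctx → Ctx → Ctx
(Γ ⊎ Δ) x = Γ x ++ Δ x

_·C_ : ℚ → Ctx → Ctx
(u ·C Γ) x = u ·I Γ x

sing : ℕ → Inter → Ctx
sing x M y = if y ≡ᵇ x then M else []

_▹_ : Ctx → Inter → Ctx
(Γ ▹ M) zero    = M
(Γ ▹ M) (suc n) = Γ n

-- Γ , z:C  for a free variable z (used with the side condition Γ z ≡ [])
extend : Ctx → ℕ → Inter → Ctx
extend Γ z C y = if y ≡ᵇ z then C else Γ y

_≈C_ : Ctx → Ctx → Set
Γ ≈C Δ = ∀ x → Γ x ≈I Δ x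

mutual
  data _⊢[_]_∶_ : Ctx → ℚ → Term → Typ → Set where
    Var  : ∀ {x M} → WFI M → sing x M ⊢[ 0ℚ ] val (var x) ∶ int M
    Zero : ∀ {M} → ∅ ⊢[ 0ℚ ] M ∶ dist []
    App  : ∀ {Γ Δ w v V W M b} →
           Γ ⊢[ w ] val V ∶ int ((1ℚ , (M ⇒ b)) ∷ []) →
           Δ ⊢[ v ] val W ∶ int M →
           (Γ ⊎ Δ) ⊢[ w + v ] app V W ∶ dist b
    Plus : ∀ {Γ Δ w v M N a b} →
           Γ ⊢[ w ] M ∶ dist a →
           Δ ⊢[ v ] N ∶ dist b →
           ((½ ·C Γ) ⊎ (½ ·C Δ)) ⊢[ ½ * w + ½ * v + 1ℚ ] (M ⊕ N) ∶ dist ((½ ·D a) ++ (½ ·D b))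
    Lam  : ∀ {Γ M w N b} →
           (Γ ▹ M) ⊢[ w ] N ∶ dist b →
           Γ ⊢[ w + 1ℚ ] val (lam N) ∶ arr (M ⇒ b)
    Let  : ∀ {Γ Θ v s N M a c} →
           Γ ⊢[ v ] N ∶ dist a →
           Branches M a Θ s c →
           (Γ ⊎ Θ) ⊢[ s + v + 1ℚ ] lett N M ∶ dist c
    ValR : ∀ {Γ w V M} →
           Γ ⊢[ w ] val V ∶ int M →
           Γ ⊢[ w ] val V ∶ dist ((1ℚ , M) ∷ [])
    Bang : ∀ {Γ w V M} →
           BangPrem V M Γ w →
           Γ ⊢[ w ] val V ∶ int M
    Conv : ∀ {Γ Γ' w M τ τ'} →
           Γ ⊢[ w ] M ∶ τ → Γ ≈C Γ' → τ ≈T τ' →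
           Γ' ⊢[ w ] M ∶ τ'

  data BangPrem (V : Val) : Inter → Ctx → ℚ → Set where
    []  : BangPrem V [] ∅ 0ℚ
    cons : ∀ {q A M Γ Δ w s} →
           0ℚ < q → q ≤ 1ℚ →
           Γ ⊢[ w ] val V ∶ arr A →
           BangPrem V M Δ s →
           BangPrem V ((q , A) ∷ M) ((q ·C Γ) ⊎ Δ) (q * w + s)

  data Branches (M : Term) : Dist → Ctx → ℚ → Dist → Set where
    []   : Branches M [] ∅ 0ℚ []
    cons : ∀ {p Mk a Δ Θ w s b c} →
           (Δ ▹ Mk) ⊢[ w ] M ∶ dist b →
           Branches M a Θ s c →
           Branches M ((p , Mk) ∷ a) ((p ·C Δ) ⊎ Θ) (p * w + s) ((p ·D b) ++ c)

mutual
  size : ∀ {Γ w M τ} → Γ ⊢[ w ] M ∶ τ → ℕ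
  size (Var _)      = 1
  size Zero         = 1
  size (App Π Φ)    = suc (size Π ℕ.+ size Φ)
  size (Plus Π Φ)   = suc (size Π ℕ.+ size Φ)
  size (Lam Π)      = suc (size Π)
  size (Let Π Bs)   = suc (size Π ℕ.+ sizeBr Bs)
  size (ValR Π)     = size Π
  size (Bang Ps)    = sizeBang Ps
  size (Conv Π _ _) = size Π

  sizeBang : ∀ {V M Γ w} → BangPrem V M Γ w → ℕ
  sizeBang []               = 0
  sizeBang (cons _ _ Π Ps)  = size Π ℕ.+ sizeBang Ps

  sizeBr : ∀ {M a Θ s c} → Branches M a Θ s c → ℕ
  sizeBr []          = 0
  sizeBr (cons Π Bs) = size Π ℕ.+ sizeBr Bs

-- Generalise to an arbitrary context Γ and an arbitrary type Γ z, given closed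
-- derivations of V for each component q·A of Γ z; inverting (!) turns Φ into such a family.
-- Induct on Π: where the context of a conclusion is a union of (scaled) premise contexts,
-- split the family accordingly, scaling its weight back; at an occurrence z : Γ z rebuild
-- (!) from the family, which costs at most the replaced (Var). Under binders V is shifted,
-- and weakening preserves weights and sizes exactly.
module Submission where

open import Defs
open import Data.Nat using (ℕ; _≤_) renaming (_+_ to _+ℕ_)
open import Data.Rational using (ℚ; _+_)
open import Data.List using ([])
open import Data.Product using (Σ)
open import Relation.Binary.PropositionalEquality using (_≡_)

import Algebra.Properties.CommutativeSemigroup as CommSemigroupProperties
open import Algebra.Bundles using (CommutativeMonoid)
open import Data.Bool using (T; true; false; if_then_else_)
open import Data.Bool.Properties using (if-float)
open import Data.Empty using (⊥-elim)
open import Data.List using (_∷_; _++_)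
open import Data.List.Properties using (++-conicalˡ; ++-conicalʳ)
open import Data.List.Relation.Binary.Permutation.Homogeneous as Perm using (Permutation; prep; swap)
open import Data.List.Relation.Binary.Pointwise.Base using (Pointwise; []; _∷_)
open import Data.Maybe as Maybe using (Maybe; just; nothing; maybe′)
open import Data.Nat using (zero; suc; _≡ᵇ_; _<ᵇ_; _≟_; z≤n; s≤s)
import Data.Nat.Properties as ℕP
open import Data.Product using (_×_; _,_; proj₁; proj₂)
open import Data.Rational using (0ℚ; 1ℚ; ½; _*_)
import Data.Rational.Properties as ℚP
open import Data.Rational.Solver using (module +-*-Solver)
open import Relation.Binary.PropositionalEquality
  using (refl; sym; trans; cong; cong₂; subst; _≗_; module ≡-Reasoning)
open import Relation.Nullary using (¬_; yes; no)

module ℕ+ = CommSemigroupProperties ℕP.+-commutativeSemigroup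
module ℚ+ = CommSemigroupProperties (CommutativeMonoid.commutativeSemigroup ℚP.+-0-commutativeMonoid)

mutual
  ≈A-refl : ∀ A → A ≈A A
  ≈A-refl (M ⇒ a) = ≈⇒ (≈I-refl M) (≈D-refl a)

  ≈I-refl : ∀ M → M ≈I M
  ≈I-refl M = perm (Perm.refl (pointwise-ElI-refl M))

  ≈D-refl : ∀ a → a ≈D a
  ≈D-refl a = perm (Perm.refl (pointwise-ElD-refl a))

  pointwise-ElI-refl : ∀ M → Pointwise ElI M M
  pointwise-ElI-refl []            = []
  pointwise-ElI-refl ((q , A) ∷ M) = elI (≈A-refl A) ∷ pointwise-ElI-refl M

  pointwise-ElD-refl : ∀ a → Pointwise ElD a a
  pointwise-ElD-refl []            = []
  pointwise-ElD-refl ((p , M) ∷ a) = elD (≈I-refl M) ∷ pointwise-ElD-refl a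

≈T-refl : ∀ τ → τ ≈T τ
≈T-refl (arr A)  = arr≈ (≈A-refl A)
≈T-refl (int M)  = int≈ (≈I-refl M)
≈T-refl (dist a) = dist≈ (≈D-refl a)

≗⇒≈C : ∀ {Γ Δ : Ctx} → Γ ≗ Δ → Γ ≈C Δ
≗⇒≈C {Γ} Γ≗Δ x = subst (Γ x ≈I_) (Γ≗Δ x) (≈I-refl (Γ x))

-- Perm.sym would hide the recursive call from the termination checker.
mutual
  ≈A-sym : ∀ {A B} → A ≈A B → B ≈A A
  ≈A-sym (≈⇒ M≈N a≈b) = ≈⇒ (≈I-sym M≈N) (≈D-sym a≈b)

  ≈I-sym : ∀ {M N} → M ≈I N → N ≈I M
  ≈I-sym (perm p) = perm (permutation-ElI-sym p)

  ≈D-sym : ∀ {a b} → a ≈D b → b ≈D a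
  ≈D-sym (perm p) = perm (permutation-ElD-sym p)

  ElI-sym : ∀ {x y} → ElI x y → ElI y x
  ElI-sym (elI A≈B) = elI (≈A-sym A≈B)

  ElD-sym : ∀ {x y} → ElD x y → ElD y x
  ElD-sym (elD M≈N) = elD (≈I-sym M≈N)

  pointwise-ElI-sym : ∀ {M N} → Pointwise ElI M N → Pointwise ElI N M
  pointwise-ElI-sym []       = []
  pointwise-ElI-sym (e ∷ es) = ElI-sym e ∷ pointwise-ElI-sym es

  pointwise-ElD-sym : ∀ {a b} → Pointwise ElD a b → Pointwise ElD b a
  pointwise-ElD-sym []       = []
  pointwise-ElD-sym (e ∷ es) = ElD-sym e ∷ pointwise-ElD-sym es

  permutation-ElI-sym : ∀ {M N} → Permutation ElI M N → Permutation ElI N M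
  permutation-ElI-sym (Perm.refl es)  = Perm.refl (pointwise-ElI-sym es)
  permutation-ElI-sym (prep e p)      = prep (ElI-sym e) (permutation-ElI-sym p)
  permutation-ElI-sym (swap e e′ p)   = swap (ElI-sym e′) (ElI-sym e) (permutation-ElI-sym p)
  permutation-ElI-sym (Perm.trans p q) = Perm.trans (permutation-ElI-sym q) (permutation-ElI-sym p)

  permutation-ElD-sym : ∀ {a b} → Permutation ElD a b → Permutation ElD b a
  permutation-ElD-sym (Perm.refl es)  = Perm.refl (pointwise-ElD-sym es)
  permutation-ElD-sym (prep e p)      = prep (ElD-sym e) (permutation-ElD-sym p)
  permutation-ElD-sym (swap e e′ p)   = swap (ElD-sym e′) (ElD-sym e) (permutation-ElD-sym p)
  permutation-ElD-sym (Perm.trans p q) = Perm.trans (permutation-ElD-sym q) (permutation-ElD-sym p)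

≈I-[]-unique : ∀ {M} → M ≈I [] → M ≡ []
≈I-[]-unique (perm p) = permutation-[] p
  where
  permutation-[] : ∀ {M} → Permutation ElI M [] → M ≡ []
  permutation-[] (Perm.refl [])   = refl
  permutation-[] (Perm.trans p q) with permutation-[] q
  ... | refl = permutation-[] p

-- Renaming contexts along partial maps on variables

rename : (ℕ → Maybe ℕ) → Ctx → Ctx
rename f Γ y = maybe′ Γ [] (f y)

under : (ℕ → Maybe ℕ) → ℕ → Maybe ℕ
under f zero    = just zero
under f (suc y) = Maybe.map suc (f y)

module _ (f : ℕ → Maybe ℕ) where

  rename-∅ : rename f ∅ ≗ ∅
  rename-∅ y with f y
  ... | nothing = refl
  ... | just _  = refl

  rename-⊎ : ∀ Γ Δ → rename f (Γ ⊎ Δ) ≗ rename f Γ ⊎ rename f Δ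
  rename-⊎ Γ Δ y with f y
  ... | nothing = refl
  ... | just _  = refl

  rename-· : ∀ u Γ → rename f (u ·C Γ) ≗ u ·C rename f Γ
  rename-· u Γ y with f y
  ... | nothing = refl
  ... | just _  = refl

  rename-·⊎ : ∀ u Γ Δ → rename f ((u ·C Γ) ⊎ Δ) ≗ (u ·C rename f Γ) ⊎ rename f Δ
  rename-·⊎ u Γ Δ y = trans (rename-⊎ (u ·C Γ) Δ y) (cong (_++ _) (rename-· u Γ y))

  rename-≈ : ∀ {Γ Δ} → Γ ≈C Δ → rename f Γ ≈C rename f Δ
  rename-≈ Γ≈Δ y with f y
  ... | nothing = ≈I-refl []
  ... | just x  = Γ≈Δ x

  rename-under-suc : ∀ Γ y → rename (under f) Γ (suc y) ≡ rename f (λ x → Γ (suc x)) y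
  rename-under-suc Γ y with f y
  ... | nothing = refl
  ... | just _  = refl

  rename-▹ : ∀ Γ M → rename (under f) (Γ ▹ M) ≗ rename f Γ ▹ M
  rename-▹ Γ M zero    = refl
  rename-▹ Γ M (suc y) = rename-under-suc (Γ ▹ M) y

-- unshift c is the partial inverse of shiftIndex c, the action of shiftV c on variables;
-- rename (delete z) only empties z, since substT does not renumber the other variables.
shiftIndex : ℕ → ℕ → ℕ
shiftIndex c x = if x <ᵇ c then x else suc x

unshift : ℕ → ℕ → Maybe ℕ
unshift zero    zero    = nothing
unshift zero    (suc y) = just y
unshift (suc c)         = under (unshift c)

delete : ℕ → ℕ → Maybe ℕ
delete zero    zero    = nothing
delete zero    (suc y) = just (suc y)
delete (suc z)         = under (delete z)

≡ᵇ-refl : ∀ n → (n ≡ᵇ n) ≡ true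
≡ᵇ-refl zero    = refl
≡ᵇ-refl (suc n) = ≡ᵇ-refl n

≡ᵇ-false : ∀ {m n} → ¬ m ≡ n → (m ≡ᵇ n) ≡ false
≡ᵇ-false {m} {n} m≢n with m ≡ᵇ n in eq
... | false = refl
... | true  = ⊥-elim (m≢n (ℕP.≡ᵇ⇒≡ m n (subst T (sym eq) _)))

sing-self : ∀ x M → sing x M x ≡ M
sing-self x M = cong (if_then M else []) (≡ᵇ-refl x)

extend-self : ∀ Γ z C → extend Γ z C z ≡ C
extend-self Γ z C = cong (if_then C else Γ z) (≡ᵇ-refl z)

shiftV-var : ∀ c x → shiftV c (var x) ≡ var (shiftIndex c x)
shiftV-var c x = sym (if-float var (x <ᵇ c))

shiftIndex-suc : ∀ c x → shiftIndex (suc c) (suc x) ≡ suc (shiftIndex c x)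
shiftIndex-suc c x = sym (if-float suc (x <ᵇ c))

rename-unshift-sing : ∀ c x M → rename (unshift c) (sing x M) ≗ sing (shiftIndex c x) M
rename-unshift-sing zero    x       M zero    = refl
rename-unshift-sing zero    x       M (suc y) = refl
rename-unshift-sing (suc c) zero    M zero    = refl
rename-unshift-sing (suc c) zero    M (suc y) =
  trans (rename-under-suc (unshift c) (sing zero M) y) (rename-∅ (unshift c) y)
rename-unshift-sing (suc c) (suc x) M y rewrite shiftIndex-suc c x with y
... | zero  = refl
... | suc y = trans (rename-under-suc (unshift c) (sing (suc x) M) y) (rename-unshift-sing c x M y)

rename-delete-sing : ∀ z M → rename (delete z) (sing z M) ≗ ∅
rename-delete-sing zero    M zero    = refl
rename-delete-sing zero    M (suc y) = refl
rename-delete-sing (suc z) M zero    = refl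
rename-delete-sing (suc z) M (suc y) =
  trans (rename-under-suc (delete z) (sing (suc z) M) y) (rename-delete-sing z M y)

rename-delete-sing-other : ∀ z x M → ¬ x ≡ z → rename (delete z) (sing x M) ≗ sing x M
rename-delete-sing-other zero    zero    M x≢z = ⊥-elim (x≢z refl)
rename-delete-sing-other zero    (suc x) M x≢z zero    = refl
rename-delete-sing-other zero    (suc x) M x≢z (suc y) = refl
rename-delete-sing-other (suc z) zero    M x≢z zero    = refl
rename-delete-sing-other (suc z) zero    M x≢z (suc y) =
  trans (rename-under-suc (delete z) (sing zero M) y) (rename-∅ (delete z) y)
rename-delete-sing-other (suc z) (suc x) M x≢z zero    = refl
rename-delete-sing-other (suc z) (suc x) M x≢z (suc y) =
  trans (rename-under-suc (delete z) (sing (suc x) M) y)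
        (rename-delete-sing-other z x M (λ x≡z → x≢z (cong suc x≡z)) y)

rename-delete-extend : ∀ Γ z C → Γ z ≡ [] → rename (delete z) (extend Γ z C) ≗ Γ
rename-delete-extend Γ zero    C Γz≡[] zero    = sym Γz≡[]
rename-delete-extend Γ zero    C Γz≡[] (suc y) = refl
rename-delete-extend Γ (suc z) C Γz≡[] zero    = refl
rename-delete-extend Γ (suc z) C Γz≡[] (suc y) =
  trans (rename-under-suc (delete z) (extend Γ (suc z) C) y)
        (rename-delete-extend (λ x → Γ (suc x)) z C Γz≡[] y)

-- The premises of (!) for V : C in the empty context; weight and sizeClosed are the
-- weight and size of that (!) instance.

data Closed (V : Val) : Inter → Set where
  []  : Closed V []
  _∷_ : ∀ {q A C w} → ∅ ⊢[ w ] val V ∶ arr A → Closed V C → Closed V ((q , A) ∷ C)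

weight : ∀ {V C} → Closed V C → ℚ
weight []                     = 0ℚ
weight (_∷_ {q} {w = w} Φ Φs) = q * w + weight Φs

sizeClosed : ∀ {V C} → Closed V C → ℕ
sizeClosed []       = 0
sizeClosed (Φ ∷ Φs) = size Φ +ℕ sizeClosed Φs

_++ᶜ_ : ∀ {V C D} → Closed V C → Closed V D → Closed V (C ++ D)
[]       ++ᶜ Ψs = Ψs
(Φ ∷ Φs) ++ᶜ Ψs = Φ ∷ (Φs ++ᶜ Ψs)

data ++-View {V} (C D : Inter) : Closed V (C ++ D) → Set where
  split : (Φs : Closed V C) (Ψs : Closed V D) → ++-View C D (Φs ++ᶜ Ψs)

++-view : ∀ {V} C {D} (Φs : Closed V (C ++ D)) → ++-View C D Φs
++-view []      Φs = split [] Φs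
++-view (_ ∷ C) (Φ ∷ Φs) with ++-view C Φs
... | split Φs₁ Φs₂ = split (Φ ∷ Φs₁) Φs₂

weight-++ᶜ : ∀ {V C D} (Φs : Closed V C) (Ψs : Closed V D) → weight (Φs ++ᶜ Ψs) ≡ weight Φs + weight Ψs
weight-++ᶜ []                     Ψs = sym (ℚP.+-identityˡ (weight Ψs))
weight-++ᶜ (_∷_ {q} {w = w} Φ Φs) Ψs =
  trans (cong (q * w +_) (weight-++ᶜ Φs Ψs)) (sym (ℚP.+-assoc (q * w) (weight Φs) (weight Ψs)))

sizeClosed-++ᶜ : ∀ {V C D} (Φs : Closed V C) (Ψs : Closed V D) → sizeClosed (Φs ++ᶜ Ψs) ≡ sizeClosed Φs +ℕ sizeClosed Ψs
sizeClosed-++ᶜ []       Ψs = refl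
sizeClosed-++ᶜ (Φ ∷ Φs) Ψs =
  trans (cong (size Φ +ℕ_) (sizeClosed-++ᶜ Φs Ψs)) (sym (ℕP.+-assoc (size Φ) (sizeClosed Φs) (sizeClosed Ψs)))

scale : ∀ {V C} u → Closed V C → Closed V (u ·I C)
scale u []       = []
scale u (Φ ∷ Φs) = Φ ∷ scale u Φs

data ·-View {V} (u : ℚ) (C : Inter) : Closed V (u ·I C) → Set where
  scaled : (Φs : Closed V C) → ·-View u C (scale u Φs)

·-view : ∀ {V} u C (Φs : Closed V (u ·I C)) → ·-View u C Φs
·-view u []      []       = scaled []
·-view u (_ ∷ C) (Φ ∷ Φs) with ·-view u C Φs
... | scaled Ψs = scaled (Φ ∷ Ψs)

weight-scale : ∀ {V C} u (Φs : Closed V C) → weight (scale u Φs) ≡ u * weight Φs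
weight-scale u []                     = sym (ℚP.*-zeroʳ u)
weight-scale u (_∷_ {q} {w = w} Φ Φs) = begin
  (u * q) * w + weight (scale u Φs) ≡⟨ cong₂ _+_ (ℚP.*-assoc u q w) (weight-scale u Φs) ⟩
  u * (q * w) + u * weight Φs       ≡⟨ ℚP.*-distribˡ-+ u (q * w) (weight Φs) ⟨
  u * (q * w + weight Φs)           ∎
  where open ≡-Reasoning

sizeClosed-scale : ∀ {V C} u (Φs : Closed V C) → sizeClosed (scale u Φs) ≡ sizeClosed Φs
sizeClosed-scale u []       = refl
sizeClosed-scale u (Φ ∷ Φs) = cong (size Φ +ℕ_) (sizeClosed-scale u Φs)

convType : ∀ {Γ w M τ τ′} → Γ ⊢[ w ] M ∶ τ → τ ≈T τ′ → Γ ⊢[ w ] M ∶ τ′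
convType Π τ≈τ′ = Conv Π (≗⇒≈C (λ _ → refl)) τ≈τ′

convCtx : ∀ {Γ Δ w M τ} → Γ ≗ Δ → Γ ⊢[ w ] M ∶ τ → Δ ⊢[ w ] M ∶ τ
convCtx Γ≗Δ Π = Conv Π (≗⇒≈C Γ≗Δ) (≈T-refl _)

module _ {V : Val} where

  pointwise-Closed : ∀ {C D} → Pointwise ElI C D → Closed V C → Closed V D
  pointwise-Closed []             []       = []
  pointwise-Closed (elI A≈B ∷ es) (Φ ∷ Φs) = convType Φ (arr≈ A≈B) ∷ pointwise-Closed es Φs

  permute-Closed : ∀ {C D} → Permutation ElI C D → Closed V C → Closed V D
  permute-Closed (Perm.refl es)     Φs       = pointwise-Closed es Φs
  permute-Closed (prep (elI A≈B) p) (Φ ∷ Φs) = convType Φ (arr≈ A≈B) ∷ permute-Closed p Φs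
  permute-Closed (swap (elI A≈B) (elI A′≈B′) p) (Φ ∷ Ψ ∷ Φs) =
    convType Ψ (arr≈ A′≈B′) ∷ convType Φ (arr≈ A≈B) ∷ permute-Closed p Φs
  permute-Closed (Perm.trans p q)   Φs       = permute-Closed q (permute-Closed p Φs)

  weight-pointwise-Closed : ∀ {C D} (es : Pointwise ElI C D) (Φs : Closed V C) → weight (pointwise-Closed es Φs) ≡ weight Φs
  weight-pointwise-Closed []             []       = refl
  weight-pointwise-Closed (elI _ ∷ es) (_∷_ {q} {w = w} Φ Φs) = cong (q * w +_) (weight-pointwise-Closed es Φs)

  weight-permute-Closed : ∀ {C D} (p : Permutation ElI C D) (Φs : Closed V C) → weight (permute-Closed p Φs) ≡ weight Φs
  weight-permute-Closed (Perm.refl es)          Φs       = weight-pointwise-Closed es Φs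
  weight-permute-Closed (prep (elI _) p) (_∷_ {q} {w = w} Φ Φs) = cong (q * w +_) (weight-permute-Closed p Φs)
  weight-permute-Closed (swap (elI _) (elI _) p) (_∷_ {q} {w = w} Φ (_∷_ {q′} {w = w′} Ψ Φs)) =
    trans (cong (λ s → q′ * w′ + (q * w + s)) (weight-permute-Closed p Φs)) (ℚ+.x∙yz≈y∙xz (q′ * w′) (q * w) (weight Φs))
  weight-permute-Closed (Perm.trans p q)        Φs       = trans (weight-permute-Closed q _) (weight-permute-Closed p Φs)

  sizeClosed-pointwise-Closed : ∀ {C D} (es : Pointwise ElI C D) (Φs : Closed V C) → sizeClosed (pointwise-Closed es Φs) ≡ sizeClosed Φs
  sizeClosed-pointwise-Closed []           []       = refl
  sizeClosed-pointwise-Closed (elI _ ∷ es) (Φ ∷ Φs) = cong (size Φ +ℕ_) (sizeClosed-pointwise-Closed es Φs)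

  sizeClosed-permute-Closed : ∀ {C D} (p : Permutation ElI C D) (Φs : Closed V C) → sizeClosed (permute-Closed p Φs) ≡ sizeClosed Φs
  sizeClosed-permute-Closed (Perm.refl es)           Φs           = sizeClosed-pointwise-Closed es Φs
  sizeClosed-permute-Closed (prep (elI _) p)         (Φ ∷ Φs)     = cong (size Φ +ℕ_) (sizeClosed-permute-Closed p Φs)
  sizeClosed-permute-Closed (swap (elI _) (elI _) p) (Φ ∷ Ψ ∷ Φs) =
    trans (cong (λ n → size Ψ +ℕ (size Φ +ℕ n)) (sizeClosed-permute-Closed p Φs)) (ℕ+.x∙yz≈y∙xz (size Ψ) (size Φ) (sizeClosed Φs))
  sizeClosed-permute-Closed (Perm.trans p q)         Φs           = trans (sizeClosed-permute-Closed q _) (sizeClosed-permute-Closed p Φs)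

  toBangPrem : ∀ {C} → WFI C → (Φs : Closed V C) → BangPrem V C ∅ (weight Φs)
  toBangPrem []                    []       = []
  toBangPrem ((0<q , q≤1 , _) ∷ wf) (Φ ∷ Φs) = cons 0<q q≤1 Φ (toBangPrem wf Φs)

  sizeBang-toBangPrem : ∀ {C} (wf : WFI C) (Φs : Closed V C) → sizeBang (toBangPrem wf Φs) ≡ sizeClosed Φs
  sizeBang-toBangPrem []       []       = refl
  sizeBang-toBangPrem (_ ∷ wf) (Φ ∷ Φs) = cong (size Φ +ℕ_) (sizeBang-toBangPrem wf Φs)

  ≈I-Closed : ∀ {C D} → C ≈I D → Closed V C → Closed V D
  ≈I-Closed (perm p) = permute-Closed p

  weight-≈I-Closed : ∀ {C D} (C≈D : C ≈I D) (Φs : Closed V C) → weight (≈I-Closed C≈D Φs) ≡ weight Φs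
  weight-≈I-Closed (perm p) = weight-permute-Closed p

  sizeClosed-≈I-Closed : ∀ {C D} (C≈D : C ≈I D) (Φs : Closed V C) → sizeClosed (≈I-Closed C≈D Φs) ≡ sizeClosed Φs
  sizeClosed-≈I-Closed (perm p) = sizeClosed-permute-Closed p

·I-[]⁻¹ : ∀ {u M} → u ·I M ≡ [] → M ≡ []
·I-[]⁻¹ {M = []} refl = refl

closedOfBang : ∀ {Γ v V C} (ps : BangPrem V C Γ v) → Γ ≗ ∅ →
               Σ (Closed V C) λ Φs → weight Φs ≡ v × sizeClosed Φs ≡ sizeBang ps
closedOfBang [] _ = [] , refl , refl
closedOfBang (cons {q} {Δ = Δ} {w = w} _ _ Φ ps) Γ≗∅ with closedOfBang ps (λ x → ++-conicalʳ _ (Δ x) (Γ≗∅ x))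
... | Φs , weight≡ , size≡ =
  convCtx (λ x → ·I-[]⁻¹ {q} (++-conicalˡ _ (Δ x) (Γ≗∅ x))) Φ ∷ Φs , cong (q * w +_) weight≡ , cong (size Φ +ℕ_) size≡

closedOf : ∀ {Γ v V C} (Φ : Γ ⊢[ v ] val V ∶ int C) → Γ ≗ ∅ →
           Σ (Closed V C) λ Φs → weight Φs ≡ v × sizeClosed Φs ≤ size Φ
closedOf (Var {x} {M} _) Γ≗∅ with trans (sym (sing-self x M)) (Γ≗∅ x)
... | refl = [] , refl , z≤n
closedOf (Bang ps) Γ≗∅ with closedOfBang ps Γ≗∅
... | Φs , weight≡ , size≡ = Φs , weight≡ , ℕP.≤-reflexive size≡
closedOf (Conv {Γ = Γ} Φ Γ≈Γ′ (int≈ C≈D)) Γ′≗∅ with closedOf Φ (λ x → ≈I-[]-unique (subst (Γ x ≈I_) (Γ′≗∅ x) (Γ≈Γ′ x)))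
... | Φs , weight≡ , size≤ =
  ≈I-Closed C≈D Φs , trans (weight-≈I-Closed C≈D Φs) weight≡ , subst (_≤ size Φ) (sym (sizeClosed-≈I-Closed C≈D Φs)) size≤

Bounded : Ctx → ℚ → Term → Typ → ℕ → Set
Bounded Γ w M τ n = Σ (Γ ⊢[ w ] M ∶ τ) λ Π → size Π ≤ n

bounded : ∀ {Γ Δ w w′ M τ n} → Γ ≗ Δ → w ≡ w′ → (Π : Γ ⊢[ w ] M ∶ τ) → size Π ≤ n → Bounded Δ w′ M τ n
bounded Γ≗Δ refl Π size≤ = convCtx Γ≗Δ Π , size≤

-- Weakening

rename-·⊎· : ∀ f u u′ Γ Δ → rename f ((u ·C Γ) ⊎ (u′ ·C Δ)) ≗ (u ·C rename f Γ) ⊎ (u′ ·C rename f Δ)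
rename-·⊎· f u u′ Γ Δ y = trans (rename-·⊎ f u Γ (u′ ·C Δ) y) (cong (_ ++_) (rename-· f u′ Δ y))

mutual
  weaken : ∀ c {Γ w M τ} (Π : Γ ⊢[ w ] M ∶ τ) →
           Σ (rename (unshift c) Γ ⊢[ w ] shiftT c M ∶ τ) λ Π′ → size Π′ ≡ size Π
  weaken c (Var {x} {M} wf) rewrite shiftV-var c x =
    convCtx (λ y → sym (rename-unshift-sing c x M y)) (Var wf) , refl
  weaken c Zero = convCtx (λ y → sym (rename-∅ (unshift c) y)) Zero , refl
  weaken c (App {Γ} {Δ} Π Φ) with weaken c Π | weaken c Φ
  ... | Π′ , Π′≡ | Φ′ , Φ′≡ =
    convCtx (λ y → sym (rename-⊎ (unshift c) Γ Δ y)) (App Π′ Φ′) , cong₂ (λ m n → suc (m +ℕ n)) Π′≡ Φ′≡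
  weaken c (Plus {Γ} {Δ} Π Φ) with weaken c Π | weaken c Φ
  ... | Π′ , Π′≡ | Φ′ , Φ′≡ =
    convCtx (λ y → sym (rename-·⊎· (unshift c) ½ ½ Γ Δ y)) (Plus Π′ Φ′) , cong₂ (λ m n → suc (m +ℕ n)) Π′≡ Φ′≡
  weaken c (Lam {Γ} {M} Π) with weaken (suc c) Π
  ... | Π′ , Π′≡ = Lam (convCtx (rename-▹ (unshift c) Γ M) Π′) , cong suc Π′≡
  weaken c (Let {Γ} {Θ} Π Bs) with weaken c Π | weakenBranches c Bs
  ... | Π′ , Π′≡ | Θ′ , Bs′ , Θ′≗ , Bs′≡ =
    convCtx (λ y → trans (cong (_ ++_) (Θ′≗ y)) (sym (rename-⊎ (unshift c) Γ Θ y))) (Let Π′ Bs′) ,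
    cong₂ (λ m n → suc (m +ℕ n)) Π′≡ Bs′≡
  weaken c (ValR Π) with weaken c Π
  ... | Π′ , Π′≡ = ValR Π′ , Π′≡
  weaken c (Bang ps) with weakenBang c ps
  ... | _ , ps′ , Γ′≗ , ps′≡ = convCtx Γ′≗ (Bang ps′) , ps′≡
  weaken c (Conv Π Γ≈Δ τ≈τ′) with weaken c Π
  ... | Π′ , Π′≡ = Conv Π′ (rename-≈ (unshift c) Γ≈Δ) τ≈τ′ , Π′≡

  weakenBang : ∀ c {V C Γ w} (ps : BangPrem V C Γ w) →
               Σ Ctx λ Γ′ → Σ (BangPrem (shiftV c V) C Γ′ w) λ ps′ →
               Γ′ ≗ rename (unshift c) Γ × sizeBang ps′ ≡ sizeBang ps
  weakenBang c [] = ∅ , [] , (λ y → sym (rename-∅ (unshift c) y)) , refl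
  weakenBang c (cons {q} {Γ = Γ} {Δ} 0<q q≤1 Π ps) with weaken c Π | weakenBang c ps
  ... | Π′ , Π′≡ | Δ′ , ps′ , Δ′≗ , ps′≡ =
    _ , cons 0<q q≤1 Π′ ps′ , (λ y → trans (cong (_ ++_) (Δ′≗ y)) (sym (rename-·⊎ (unshift c) q Γ Δ y))) ,
    cong₂ _+ℕ_ Π′≡ ps′≡

  weakenBranches : ∀ c {M a Θ s b} (Bs : Branches M a Θ s b) →
                   Σ Ctx λ Θ′ → Σ (Branches (shiftT (suc c) M) a Θ′ s b) λ Bs′ →
                   Θ′ ≗ rename (unshift c) Θ × sizeBr Bs′ ≡ sizeBr Bs
  weakenBranches c [] = ∅ , [] , (λ y → sym (rename-∅ (unshift c) y)) , refl
  weakenBranches c (cons {p} {Mk} {Δ = Δ} {Θ} Π Bs) with weaken (suc c) Π | weakenBranches c Bs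
  ... | Π′ , Π′≡ | Θ′ , Bs′ , Θ′≗ , Bs′≡ =
    _ , cons (convCtx (rename-▹ (unshift c) Δ Mk) Π′) Bs′ ,
    (λ y → trans (cong (_ ++_) (Θ′≗ y)) (sym (rename-·⊎ (unshift c) p Δ Θ y))) , cong₂ _+ℕ_ Π′≡ Bs′≡

shift-Closed : ∀ {V C} → Closed V C → Closed (shiftV 0 V) C
shift-Closed []       = []
shift-Closed (Φ ∷ Φs) = convCtx (rename-∅ (unshift 0)) (proj₁ (weaken 0 Φ)) ∷ shift-Closed Φs

weight-shift-Closed : ∀ {V C} (Φs : Closed V C) → weight (shift-Closed Φs) ≡ weight Φs
weight-shift-Closed []                     = refl
weight-shift-Closed (_∷_ {q} {w = w} Φ Φs) = cong (q * w +_) (weight-shift-Closed Φs)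

sizeClosed-shift-Closed : ∀ {V C} (Φs : Closed V C) → sizeClosed (shift-Closed Φs) ≡ sizeClosed Φs
sizeClosed-shift-Closed []       = refl
sizeClosed-shift-Closed (Φ ∷ Φs) = cong₂ _+ℕ_ (proj₂ (weaken 0 Φ)) (sizeClosed-shift-Closed Φs)

-- Substitution

substitution-var : ∀ z V x M (wf : WFI M) (Φs : Closed V (sing x M z)) →
                   Bounded (rename (delete z) (sing x M)) (0ℚ + weight Φs) (substT z V (val (var x))) (int M)
                           (1 +ℕ sizeClosed Φs)
substitution-var z V x M wf Φs with x ≟ z
... | yes refl with z ≡ᵇ z | ≡ᵇ-refl z
...   | .true | refl =
  bounded (λ y → sym (rename-delete-sing z M y)) (sym (ℚP.+-identityˡ _))
          (Bang (toBangPrem wf Φs)) (ℕP.m≤n⇒m≤1+n (ℕP.≤-reflexive (sizeBang-toBangPrem wf Φs)))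
substitution-var z V x M wf Φs | no x≢z with z ≡ᵇ x | ≡ᵇ-false (λ z≡x → x≢z (sym z≡x)) | x ≡ᵇ z | ≡ᵇ-false x≢z
...   | .false | refl | .false | refl with Φs
...     | [] = bounded (λ y → sym (rename-delete-sing-other z x M x≢z y)) refl (Var wf) (ℕP.≤-refl)

module _ where
  open +-*-Solver

  App-weight : ∀ w c v d → (w + c) + (v + d) ≡ (w + v) + (c + d)
  App-weight = solve 4 (λ w c v d → (w :+ c) :+ (v :+ d) := (w :+ v) :+ (c :+ d)) refl

  Plus-weight : ∀ w c v d → ½ * (w + c) + ½ * (v + d) + 1ℚ ≡ (½ * w + ½ * v + 1ℚ) + (½ * c + ½ * d)
  Plus-weight = solve 4 (λ w c v d → con ½ :* (w :+ c) :+ con ½ :* (v :+ d) :+ con 1ℚ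
                                  := (con ½ :* w :+ con ½ :* v :+ con 1ℚ) :+ (con ½ :* c :+ con ½ :* d)) refl

  Lam-weight : ∀ w c → (w + c) + 1ℚ ≡ (w + 1ℚ) + c
  Lam-weight = solve 2 (λ w c → (w :+ c) :+ con 1ℚ := (w :+ con 1ℚ) :+ c) refl

  Let-weight : ∀ s d v c → (s + d) + (v + c) + 1ℚ ≡ (s + v + 1ℚ) + (c + d)
  Let-weight = solve 4 (λ s d v c → (s :+ d) :+ (v :+ c) :+ con 1ℚ := (s :+ v :+ con 1ℚ) :+ (c :+ d)) refl

  cons-weight : ∀ p w c s d → p * (w + c) + (s + d) ≡ (p * w + s) + (p * c + d)
  cons-weight = solve 5 (λ p w c s d → p :* (w :+ c) :+ (s :+ d) := (p :* w :+ s) :+ (p :* c :+ d)) refl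

module _ {V : Val} {C D : Inter} (Φs : Closed V C) (Ψs : Closed V D) where

  size-++ᶜ-≤ : ∀ {a b A B} → a ≤ A +ℕ sizeClosed Φs → b ≤ B +ℕ sizeClosed Ψs →
               a +ℕ b ≤ (A +ℕ B) +ℕ sizeClosed (Φs ++ᶜ Ψs)
  size-++ᶜ-≤ {A = A} {B} a≤ b≤ = ℕP.≤-trans (ℕP.+-mono-≤ a≤ b≤) (ℕP.≤-reflexive (begin
    (A +ℕ sizeClosed Φs) +ℕ (B +ℕ sizeClosed Ψs) ≡⟨ ℕ+.interchange A _ B _ ⟩
    (A +ℕ B) +ℕ (sizeClosed Φs +ℕ sizeClosed Ψs) ≡⟨ cong ((A +ℕ B) +ℕ_) (sizeClosed-++ᶜ Φs Ψs) ⟨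
    (A +ℕ B) +ℕ sizeClosed (Φs ++ᶜ Ψs)           ∎))
    where open ≡-Reasoning

  weight-scale-++ᶜ : ∀ u → weight (scale u Φs ++ᶜ Ψs) ≡ u * weight Φs + weight Ψs
  weight-scale-++ᶜ u = trans (weight-++ᶜ (scale u Φs) Ψs) (cong (_+ weight Ψs) (weight-scale u Φs))

≤-+ʳ-≡ : ∀ {a A m n} → m ≡ n → a ≤ A +ℕ m → a ≤ A +ℕ n
≤-+ʳ-≡ {a} {A} = subst (λ k → a ≤ A +ℕ k)

mutual
  substitution : ∀ z V {Γ w M τ} (Π : Γ ⊢[ w ] M ∶ τ) (Φs : Closed V (Γ z)) →
                 Bounded (rename (delete z) Γ) (w + weight Φs) (substT z V M) τ (size Π +ℕ sizeClosed Φs)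
  substitution z V (Var {x} {M} wf) Φs = substitution-var z V x M wf Φs
  substitution z V Zero [] = bounded (λ y → sym (rename-∅ (delete z) y)) refl Zero (ℕP.≤-refl)
  substitution z V (App {Γ} {Δ} {w} {v} Π₁ Π₂) Φs with ++-view (Γ z) Φs
  ... | split Φs₁ Φs₂ with substitution z V Π₁ Φs₁ | substitution z V Π₂ Φs₂
  ... | P₁ , P₁≤ | P₂ , P₂≤ =
    bounded (λ y → sym (rename-⊎ (delete z) Γ Δ y))
            (trans (App-weight w _ v _) (cong ((w + v) +_) (sym (weight-++ᶜ Φs₁ Φs₂))))
            (App P₁ P₂) (s≤s (size-++ᶜ-≤ Φs₁ Φs₂ P₁≤ P₂≤))
  substitution z V (Plus {Γ} {Δ} {w} {v} Π₁ Π₂) Φs with ++-view (½ ·I Γ z) Φs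
  ... | split Φs₁ Φs₂ with ·-view ½ (Γ z) Φs₁ | ·-view ½ (Δ z) Φs₂
  ... | scaled Ψs₁ | scaled Ψs₂ with substitution z V Π₁ Ψs₁ | substitution z V Π₂ Ψs₂
  ... | P₁ , P₁≤ | P₂ , P₂≤ =
    bounded (λ y → sym (rename-·⊎· (delete z) ½ ½ Γ Δ y))
            (trans (Plus-weight w _ v _) (cong ((½ * w + ½ * v + 1ℚ) +_) (sym weight≡)))
            (Plus P₁ P₂) (s≤s (size-++ᶜ-≤ (scale ½ Ψs₁) (scale ½ Ψs₂) (rescale Ψs₁ P₁≤) (rescale Ψs₂ P₂≤)))
    where
    weight≡ : weight (scale ½ Ψs₁ ++ᶜ scale ½ Ψs₂) ≡ ½ * weight Ψs₁ + ½ * weight Ψs₂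
    weight≡ = trans (weight-scale-++ᶜ Ψs₁ (scale ½ Ψs₂) ½) (cong (½ * weight Ψs₁ +_) (weight-scale ½ Ψs₂))

    rescale : ∀ {a A C} (Ψs : Closed V C) → a ≤ A +ℕ sizeClosed Ψs → a ≤ A +ℕ sizeClosed (scale ½ Ψs)
    rescale Ψs = ≤-+ʳ-≡ (sym (sizeClosed-scale ½ Ψs))
  substitution z V (Lam {Γ} {M} {w} Π) Φs with substitution (suc z) (shiftV 0 V) Π (shift-Closed Φs)
  ... | P , P≤ =
    bounded (λ _ → refl) (trans (Lam-weight w _) (cong ((w + 1ℚ) +_) (weight-shift-Closed Φs)))
            (Lam (convCtx (rename-▹ (delete z) Γ M) P))
            (s≤s (≤-+ʳ-≡ (sizeClosed-shift-Closed Φs) P≤))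
  substitution z V (Let {Γ} {Θ} {v} {s} Π Bs) Φs with ++-view (Γ z) Φs
  ... | split Φs₁ Φs₂ with substitution z V Π Φs₁ | substitution-branches z V Bs Φs₂
  ... | P , P≤ | _ , _ , Bs′ , Θ′≗ , refl , Bs′≤ =
    bounded (λ y → trans (cong (_ ++_) (Θ′≗ y)) (sym (rename-⊎ (delete z) Γ Θ y)))
            (trans (Let-weight s _ v _) (cong ((s + v + 1ℚ) +_) (sym (weight-++ᶜ Φs₁ Φs₂))))
            (Let P Bs′) (s≤s (size-++ᶜ-≤ Φs₁ Φs₂ P≤ Bs′≤))
  substitution z V (ValR Π) Φs = let P , P≤ = substitution z V Π Φs in ValR P , P≤
  substitution z V (Bang ps) Φs with substitution-bang z V ps Φs
  ... | _ , _ , ps′ , Γ′≗ , refl , ps′≤ = bounded Γ′≗ refl (Bang ps′) ps′≤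
  substitution z V (Conv {w = w} Π Γ≈Γ′ τ≈τ′) Φs with substitution z V Π (≈I-Closed (≈I-sym (Γ≈Γ′ z)) Φs)
  ... | P , P≤ =
    bounded (λ _ → refl) (cong (w +_) (weight-≈I-Closed (≈I-sym (Γ≈Γ′ z)) Φs))
            (Conv P (rename-≈ (delete z) Γ≈Γ′) τ≈τ′)
            (≤-+ʳ-≡ (sizeClosed-≈I-Closed (≈I-sym (Γ≈Γ′ z)) Φs) P≤)

  substitution-bang : ∀ z V {U C Γ w} (ps : BangPrem U C Γ w) (Φs : Closed V (Γ z)) →
                      Σ Ctx λ Γ′ → Σ ℚ λ w′ → Σ (BangPrem (substV z V U) C Γ′ w′) λ ps′ →
                      Γ′ ≗ rename (delete z) Γ × w′ ≡ w + weight Φs × sizeBang ps′ ≤ sizeBang ps +ℕ sizeClosed Φs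
  substitution-bang z V [] [] = ∅ , 0ℚ , [] , (λ y → sym (rename-∅ (delete z) y)) , refl , z≤n
  substitution-bang z V (cons {q} {Γ = Γ} {Δ} {w} {s} 0<q q≤1 Π ps) Φs with ++-view (q ·I Γ z) Φs
  ... | split Φs₁ Φs₂ with ·-view q (Γ z) Φs₁
  ... | scaled Ψs₁ with substitution z V Π Ψs₁ | substitution-bang z V ps Φs₂
  ... | P , P≤ | _ , _ , ps′ , Δ′≗ , refl , ps′≤ =
    _ , _ , cons 0<q q≤1 P ps′ ,
    (λ y → trans (cong (_ ++_) (Δ′≗ y)) (sym (rename-·⊎ (delete z) q Γ Δ y))) ,
    trans (cons-weight q w _ s _) (cong ((q * w + s) +_) (sym (weight-scale-++ᶜ Ψs₁ Φs₂ q))) ,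
    size-++ᶜ-≤ (scale q Ψs₁) Φs₂ (≤-+ʳ-≡ (sym (sizeClosed-scale q Ψs₁)) P≤) ps′≤

  substitution-branches : ∀ z V {M a Θ s b} (Bs : Branches M a Θ s b) (Φs : Closed V (Θ z)) →
                          Σ Ctx λ Θ′ → Σ ℚ λ s′ → Σ (Branches (substT (suc z) (shiftV 0 V) M) a Θ′ s′ b) λ Bs′ →
                          Θ′ ≗ rename (delete z) Θ × s′ ≡ s + weight Φs × sizeBr Bs′ ≤ sizeBr Bs +ℕ sizeClosed Φs
  substitution-branches z V [] [] = ∅ , 0ℚ , [] , (λ y → sym (rename-∅ (delete z) y)) , refl , z≤n
  substitution-branches z V (cons {p} {Mk} {Δ = Δ} {Θ} {w} {s} Π Bs) Φs with ++-view (p ·I Δ z) Φs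
  ... | split Φs₁ Φs₂ with ·-view p (Δ z) Φs₁
  ... | scaled Ψs₁ with substitution (suc z) (shiftV 0 V) Π (shift-Closed Ψs₁) | substitution-branches z V Bs Φs₂
  ... | P , P≤ | _ , _ , Bs′ , Θ′≗ , refl , Bs′≤ =
    _ , _ , cons (convCtx (rename-▹ (delete z) Δ Mk) P) Bs′ ,
    (λ y → trans (cong (_ ++_) (Θ′≗ y)) (sym (rename-·⊎ (delete z) p Δ Θ y))) ,
    trans (cong (λ c → p * (w + c) + (s + weight Φs₂)) (weight-shift-Closed Ψs₁))
          (trans (cons-weight p w _ s _) (cong ((p * w + s) +_) (sym (weight-scale-++ᶜ Ψs₁ Φs₂ p)))) ,
    size-++ᶜ-≤ (scale p Ψs₁) Φs₂
      (≤-+ʳ-≡ (trans (sizeClosed-shift-Closed Ψs₁) (sym (sizeClosed-scale p Ψs₁))) P≤) Bs′≤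

substitution-extend : ∀ {Γ z C M V w τ} → Γ z ≡ [] → (Π : extend Γ z C ⊢[ w ] M ∶ τ) (Φs : Closed V C) →
                      Bounded Γ (w + weight Φs) (substT z V M) τ (size Π +ℕ sizeClosed Φs)
substitution-extend {Γ} {z} {C} {V = V} {w} Γz≡[] Π Φs =
  let P , P≤ = substitution z V Π (≈I-Closed C≈Cz Φs) in
  bounded (rename-delete-extend Γ z C Γz≡[]) (cong (w +_) (weight-≈I-Closed C≈Cz Φs)) P
          (≤-+ʳ-≡ (sizeClosed-≈I-Closed C≈Cz Φs) P≤)
  where
  C≈Cz : C ≈I extend Γ z C z
  C≈Cz = subst (C ≈I_) (sym (extend-self Γ z C)) (≈I-refl C)

mainTheorem5 : ∀ {Γ : Ctx} {z : ℕ} {C : Inter} {M : Term} {V : Val} {w v : ℚ} {τ : Typ} →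
    Γ z ≡ [] →
    (Π : extend Γ z C ⊢[ w ] M ∶ τ) →
    (Φ : ∅ ⊢[ v ] val V ∶ int C) →
    Σ (Γ ⊢[ w + v ] substT z V M ∶ τ) (λ Π' → size Π' ≤ size Π +ℕ size Φ)
mainTheorem5 Γz≡[] Π Φ with closedOf Φ (λ _ → refl)
... | Φs , refl , Φs≤ =
  let P , P≤ = substitution-extend Γz≡[] Π Φs in P , ℕP.≤-trans P≤ (ℕP.+-monoʳ-≤ (size Π) Φs≤)
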